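{- If $\Omega$ is a negative prime $\mathsf{LRIF}$-theory, then for all positive natural numbers $m,n$: $\Omega^{m(*)}\subseteq\Omega^{n(*)}$ or $\Omega^{n(*)}\subseteq\Omega^{m(*)}$.
   Context: Let $L$ be the set of formulas built from a set $At$ of atomic formulas with $\wedge,\vee,\neg$; an $L$-pair is written $\alpha\vdash\beta$. For $n\in\mathbb{N}$, $\neg^n\alpha$ is $\alpha$ preceded by $n$ negations. $\mathsf{LRIF}$ is the set of $L$-pairs derivable in the system with, for all formulas $\alpha,\beta,\gamma$, the axioms $\alpha\vdash\alpha$; $\alpha\wedge\beta\vdash\alpha$; $\alpha\wedge\beta\vdash\beta$; $\alpha\vdash\alpha\vee\beta$; $\beta\vdash\alpha\vee\beta$; $\neg(\alpha\wedge\beta)\vdash\neg\alpha\vee\neg\beta$; $\neg\neg\alpha\wedge\neg\neg\beta\vdash\neg(\neg\alpha\vee\neg\beta)$; $\alpha\wedge(\neg\beta\vee\neg\gamma)\vdash(\alpha\wedge\neg\beta)\vee(\alpha\wedge\neg\gamma)$; and, for every positive natural number $k$, $\neg\alpha\wedge\neg^{2k+1}\beta\vdash\neg^{2k+1}\alpha\vee\neg\beta$ and $\neg\alpha\wedge\neg^{2k}\alpha\vdash\neg\beta\vee\neg^{2k}\beta$; and the rules: from $\alpha\vdash\beta$ and $\beta\vdash\gamma$ infer $\alpha\vdash\gamma$; from $\alpha\vdash\beta$ and $\alpha\vdash\gamma$ infer $\alpha\vdash\beta\wedge\gamma$; from $\alpha\vdash\gamma$ and $\beta\vdash\gamma$ infer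 $\alpha\vee\beta\vdash\gamma$; from $\alpha\vdash\beta$ infer $\neg\beta\vdash\neg\alpha$. A set of formulas $\Omega$ is a negative prime $\mathsf{LRIF}$-theory if (a) $\alpha\in\Omega$ and $\alpha\vdash\beta\in\mathsf{LRIF}$ imply $\beta\in\Omega$; (b) $\alpha,\beta\in\Omega$ imply $\alpha\wedge\beta\in\Omega$; (c) $\neg\alpha\vee\neg\beta\in\Omega$ implies $\neg\alpha\in\Omega$ or $\neg\beta\in\Omega$. For a set of formulas $\Omega$, $\Omega^*=\{\alpha\in L\mid\neg\alpha\notin\Omega\}$, and $\Omega^{n(*)}$ denotes the result of applying $*$ $n$ times to $\Omega$ ($\Omega^{0(*)}=\Omega$). -}

module Defs where

open import Data.Nat using (ℕ; zero; suc; _+_; _*_; _≤_)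
open import Data.Sum using (_⊎_)
open import Relation.Nullary using (¬_)

data Formula (At : Set) : Set where
  atom : At → Formula At
  _∧_  : Formula At → Formula At → Formula At
  _∨_  : Formula At → Formula At → Formula At
  ~_   : Formula At → Formula At

infixr 6 _∧_
infixr 5 _∨_
infix 7 ~_

~^ : {At : Set} → ℕ → Formula At → Formula At
~^ zero    α = α
~^ (suc n) α = ~ (~^ n α)

infix 3 _⊢_
data _⊢_ {At : Set} : Formula At → Formula At → Set where
  ax-id     : ∀ {α} → α ⊢ α
  ax-∧e₁    : ∀ {α β} → α ∧ β ⊢ α
  ax-∧e₂    : ∀ {α β} → α ∧ β ⊢ β
  ax-∨i₁    : ∀ {α β} → α ⊢ α ∨ β
  ax-∨i₂    : ∀ {α β} → β ⊢ α ∨ β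
  ax-dm     : ∀ {α β} → ~ (α ∧ β) ⊢ ~ α ∨ ~ β
  ax-dnn    : ∀ {α β} → ~ ~ α ∧ ~ ~ β ⊢ ~ (~ α ∨ ~ β)
  ax-dist   : ∀ {α β γ} → α ∧ (~ β ∨ ~ γ) ⊢ (α ∧ ~ β) ∨ (α ∧ ~ γ)
  ax-odd    : ∀ {α β} (k : ℕ) → 1 ≤ k →
              ~ α ∧ ~^ (2 * k + 1) β ⊢ ~^ (2 * k + 1) α ∨ ~ β
  ax-even   : ∀ {α β} (k : ℕ) → 1 ≤ k →
              ~ α ∧ ~^ (2 * k) α ⊢ ~ β ∨ ~^ (2 * k) β
  r-cut     : ∀ {α β γ} → α ⊢ β → β ⊢ γ → α ⊢ γ
  r-∧i      : ∀ {α β γ} → α ⊢ β → α ⊢ γ → α ⊢ β ∧ γ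
  r-∨e      : ∀ {α β γ} → α ⊢ γ → β ⊢ γ → α ∨ β ⊢ γ
  r-contra  : ∀ {α β} → α ⊢ β → ~ β ⊢ ~ α

Theory : Set → Set₁
Theory At = Formula At → Set

_⊆_ : {At : Set} → Theory At → Theory At → Set
Ω ⊆ Δ = ∀ α → Ω α → Δ α

record NegPrimeTheory {At : Set} (Ω : Theory At) : Set where
  field
    closed   : ∀ {α β} → Ω α → α ⊢ β → Ω β
    conj     : ∀ {α β} → Ω α → Ω β → Ω (α ∧ β)
    negPrime : ∀ {α β} → Ω (~ α ∨ ~ β) → Ω (~ α) ⊎ Ω (~ β)

_* : {At : Set} → Theory At → Theory At
(Ω *) α = ¬ Ω (~ α)

*^ : {At : Set} → ℕ → Theory At → Theory At
*^ zero    Ω = Ω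
*^ (suc n) Ω = (*^ n Ω) *

-- Unfolding the definitions, α ∈ Ω^{n(*)} holds iff n meta-level negations of (¬ⁿα ∈ Ω) do.
-- If Ω^{m(*)} and Ω^{n(*)} were incomparable for 1 ≤ m ≤ n, there would be
-- α ∈ Ω^{m(*)} ∖ Ω^{n(*)} and β ∈ Ω^{n(*)} ∖ Ω^{m(*)}; with a = ¬^{m-1}α, b = ¬^{m-1}β and
-- j = n - m + 1 these are memberships of ¬a, ¬ʲa, ¬b, ¬ʲb in Ω under meta-level negations.
-- Classically, removing one negation from all four only swaps a and b, so all of them can be
-- stripped; then the LRIF axiom for odd j (resp. even j) followed by negative primeness puts
-- ¬ʲa or ¬b (resp. ¬b or ¬ʲb) into Ω, contradicting the hypotheses.
module Submission where

open import Defs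
open import Data.Nat using (ℕ; zero; suc; _+_; _*_; _≤_; z≤n; s≤s)
open import Data.Nat.Properties using (+-comm; *-suc; ≤-total; m≤n⇒∃[o]m+o≡n)
open import Data.Product using (_,_)
open import Data.Sum using (_⊎_; inj₁; inj₂; [_,_]; swap)
open import Data.Empty using (⊥)
open import Function using (id)
open import Relation.Nullary using (¬_)
open import Relation.Binary.PropositionalEquality using (_≡_; refl; cong; sym; trans; subst)
open import Level using (0ℓ)
open import Axiom.ExcludedMiddle using (ExcludedMiddle)
open import Axiom.DoubleNegationElimination using (DoubleNegationElimination; em⇒dne)

~^-+ : ∀ {At} m n (α : Formula At) → ~^ (m + n) α ≡ ~^ m (~^ n α)
~^-+ zero    n α = refl
~^-+ (suc m) n α = cong ~_ (~^-+ m n α)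

~^-suc : ∀ {At} n (α : Formula At) → ~^ n (~ α) ≡ ~ (~^ n α)
~^-suc zero    α = refl
~^-suc (suc n) α = cong ~_ (~^-suc n α)

¬^ : ℕ → Set → Set
¬^ zero    P = P
¬^ (suc n) P = ¬ ¬^ n P

*^≡¬^ : ∀ {At} (Ω : Theory At) n α → *^ n Ω α ≡ ¬^ n (Ω (~^ n α))
*^≡¬^ Ω zero    α = refl
*^≡¬^ Ω (suc n) α =
  cong ¬_ (trans (*^≡¬^ Ω n (~ α)) (cong (λ β → ¬^ n (Ω β)) (~^-suc n α)))

*^-suc-+≡¬^ : ∀ {At} (Ω : Theory At) p d α →
              *^ (suc p + d) Ω α ≡ ¬^ (suc p + d) (Ω (~^ (suc d) (~^ p α)))
*^-suc-+≡¬^ Ω p d α = trans (*^≡¬^ Ω (suc p + d) α) (cong (λ β → ¬^ (suc p + d) (Ω β)) shift)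
  where
  shift : ~^ (suc p + d) α ≡ ~^ (suc d) (~^ p α)
  shift = trans (cong (λ k → ~^ (suc k) α) (+-comm p d)) (~^-+ (suc d) p α)

data Parity : ℕ → Set where
  even : ∀ k → Parity (2 * k)
  odd  : ∀ k → Parity (suc (2 * k))

parity : ∀ n → Parity n
parity zero = even 0
parity (suc n) with parity n
... | even k = odd k
... | odd k  = subst Parity (*-suc 2 k) (even (suc k))

module _ {At : Set} {Ω : Theory At} (Ω-prime : NegPrimeTheory Ω) where
  open NegPrimeTheory Ω-prime

  negPrime-odd : ∀ k → 1 ≤ k → ∀ {a b} → Ω (~ a) → Ω (~^ (suc (2 * k)) b) →
                 Ω (~^ (suc (2 * k)) a) ⊎ Ω (~ b)
  negPrime-odd k k≥1 {a} {b} ~a∈Ω b∈Ω = negPrime (closed (conj ~a∈Ω b∈Ω) axiom)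
    where
    axiom : ~ a ∧ ~^ (suc (2 * k)) b ⊢ ~^ (suc (2 * k)) a ∨ ~ b
    axiom = subst (λ j → ~ a ∧ ~^ j b ⊢ ~^ j a ∨ ~ b) (+-comm (2 * k) 1) (ax-odd k k≥1)

  negPrime-even : ∀ k → 1 ≤ k → ∀ {a b} → Ω (~ a) → Ω (~^ (2 * k) a) →
                  Ω (~ b) ⊎ Ω (~^ (2 * k) b)
  negPrime-even k@(suc _) k≥1 ~a∈Ω a∈Ω = negPrime (closed (conj ~a∈Ω a∈Ω) (ax-even k k≥1))

¬^-2*-intro : ∀ k {P} → P → ¬^ (2 * k) P
¬^-2*-intro zero        p = p
¬^-2*-intro (suc k) {P} p = subst (λ n → ¬^ n P) (sym (*-suc 2 k)) (λ ¬h → ¬h (¬^-2*-intro k p))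

module _ (dne : DoubleNegationElimination 0ℓ) where

  ¬^-2*-elim : ∀ k {P} → ¬^ (2 * k) P → P
  ¬^-2*-elim zero        h = h
  ¬^-2*-elim (suc k) {P} h = ¬^-2*-elim k (dne (subst (λ n → ¬^ n P) (*-suc 2 k) h))

  module _ {At : Set} {Ω : Theory At} (Ω-prime : NegPrimeTheory Ω) where

    no-crossing₀ : ∀ {j} → Parity j → 1 ≤ j → ∀ a b →
                   Ω (~ a) → ¬^ j (Ω (~^ j a)) → ¬ ¬^ j (Ω (~^ j b)) → ¬ Ω (~ b) → ⊥
    no-crossing₀ (even zero)    ()
    no-crossing₀ (even (suc k)) _ a b a∈m a∉n b∈n b∉m =
      [ b∉m , (λ x∈Ω → b∈n (¬^-2*-intro (suc k) x∈Ω)) ]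
        (negPrime-even Ω-prime (suc k) (s≤s z≤n) a∈m (¬^-2*-elim (suc k) a∉n))
    no-crossing₀ (odd zero)     _ a b a∈m a∉n b∈n b∉m = a∉n a∈m
    no-crossing₀ (odd (suc k))  _ a b a∈m a∉n b∈n b∉m =
      [ (λ x∈Ω → a∉n (¬^-2*-intro (suc k) x∈Ω)) , b∉m ]
        (negPrime-odd Ω-prime (suc k) (s≤s z≤n) a∈m (¬^-2*-elim (suc k) (dne b∈n)))

    no-crossing : ∀ i d a b →
                  ¬^ i (Ω (~ a)) → ¬ ¬^ (i + d) (Ω (~^ (suc d) a)) →
                  ¬^ (i + d) (Ω (~^ (suc d) b)) → ¬ ¬^ i (Ω (~ b)) → ⊥
    no-crossing zero    d a b a∈m a∉n b∈n b∉m =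
      no-crossing₀ (parity (suc d)) (s≤s z≤n) a b a∈m a∉n (λ ¬b∈n → ¬b∈n b∈n) b∉m
    no-crossing (suc i) d a b a∈m a∉n b∈n b∉m = no-crossing i d b a (dne b∉m) b∈n (dne a∉n) a∈m

    *^-comparable-+ : ∀ p d → (*^ (suc p) Ω ⊆ *^ (suc p + d) Ω) ⊎ (*^ (suc p + d) Ω ⊆ *^ (suc p) Ω)
    *^-comparable-+ p d = dne λ neither →
      neither (inj₂ λ β β∈n → dne λ β∉m →
      neither (inj₁ λ α α∈m → dne λ α∉n →
        no-crossing (suc p) d (~^ p α) (~^ p β)
          (subst id (*^≡¬^ Ω (suc p) α) α∈m)
          (λ h → α∉n (subst id (sym (*^-suc-+≡¬^ Ω p d α)) h))
          (subst id (*^-suc-+≡¬^ Ω p d β) β∈n)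
          (λ h → β∉m (subst id (sym (*^≡¬^ Ω (suc p) β)) h))))

    *^-comparable-≤ : ∀ m n → 1 ≤ m → m ≤ n → (*^ m Ω ⊆ *^ n Ω) ⊎ (*^ n Ω ⊆ *^ m Ω)
    *^-comparable-≤ (suc p) n _ m≤n with m≤n⇒∃[o]m+o≡n m≤n
    ... | d , refl = *^-comparable-+ p d

lemma5 : ExcludedMiddle 0ℓ →
         {At : Set} (Ω : Theory At) → NegPrimeTheory Ω →
         (m n : ℕ) → 1 ≤ m → 1 ≤ n →
         (*^ m Ω ⊆ *^ n Ω) ⊎ (*^ n Ω ⊆ *^ m Ω)
lemma5 em Ω Ω-prime m n 1≤m 1≤n with ≤-total m n
... | inj₁ m≤n = *^-comparable-≤ (em⇒dne em) Ω-prime m n 1≤m m≤n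
... | inj₂ n≤m = swap (*^-comparable-≤ (em⇒dne em) Ω-prime n m 1≤n n≤m)
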